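{- For all types $A,B$: if $A\equiv B$, then $[\![\mathrm{can}(A)]\!]=[\![\mathrm{can}(B)]\!]$.
   Context: Types: $A,B,C::=\tau\mid A\Rightarrow B\mid A\wedge B$ with a single atomic type $\tau$. $\equiv$ is the smallest congruence on types containing $A\wedge B\equiv B\wedge A$, $(A\wedge B)\wedge C\equiv A\wedge(B\wedge C)$, $A\Rightarrow(B\wedge C)\equiv(A\Rightarrow B)\wedge(A\Rightarrow C)$, $(A\wedge B)\Rightarrow C\equiv A\Rightarrow B\Rightarrow C$. Terms: $r,s,t::=x^A\mid \lambda x^A.r\mid r\,s\mid r+s\mid \pi_A(r)$, variables labelled by types, up to $\alpha$-equivalence. $\mathrm{vars}(r)$: labelled variables of $r$; functional set: $x^A,x^B$ in it implies $A=B$. $r[s/x]$ capture-avoiding substitution; $r[A/B]$ replaces every occurrence of type $B$ in $r$ by $A$. Typing: $x^A:A$; if $r:A$, $A\equiv B$ then $r:B$; if $r:B$, $\mathrm{vars}(r)\cup\{x^A\}$ functional then $\lambda x^A.r:A\Rightarrow B$; if $r:A\Rightarrow B$, $s:A$, $\mathrm{vars}(rs)$ functional then $rs:B$; if $r:A$, $s:B$, $\mathrm{vars}(r+s)$ functional then $r+s:A\wedge B$; if $r:A$ then $\pi_A(r):A$; if $r:A\wedge B$ then $\pi_A(r):A$. $\rightleftarrows$ (both directions, closed under all contexts $C[\cdot]::=[\cdot]\mid\lambda x^A.C[\cdot]\mid C[\cdot]r\mid rC[\cdot]\mid C[\cdot]+r\mid r+C[\cdot]\mid\pi_A(C[\cdot])$):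 $r+s\rightleftarrows s+r$; $(r+s)+t\rightleftarrows r+(s+t)$; $\lambda x^A.(r+s)\rightleftarrows\lambda x^A.r+\lambda x^A.s$; $(r+s)t\rightleftarrows rt+st$; $\pi_{A\Rightarrow B}(\lambda x^A.r)\rightleftarrows\lambda x^A.\pi_B(r)$; if $r:A\Rightarrow(B\wedge C)$, $\pi_{A\Rightarrow B}(r)s\rightleftarrows\pi_B(rs)$; $(rs)t\rightleftarrows r(s+t)$; if $A\equiv B$, $r\rightleftarrows r[A/B]$; if $r:A\wedge B$, $s:C\wedge D$, $\pi_{A\wedge C}(r+s)\rightleftarrows\pi_A(r)+\pi_C(s)$. Reductions $\hookrightarrow$: if $s:A$, $(\lambda x^A.r)s\hookrightarrow r[s/x]$; if $r:A$, $\pi_A(r+s)\hookrightarrow r$; if $r:A$, $\pi_A(r)\hookrightarrow r$ (these closed under all contexts); ($\delta$) if $r:A\wedge B$ and $r$ is not $\rightleftarrows^*$-equivalent to any $s+t$, then $r\hookrightarrow\pi_A(r)+\pi_B(r)$, closed only under contexts not $\rightleftarrows^*$-equivalent to a context $C'[\pi_A(\cdot)]$. $r\rightsquigarrow s$ iff $r\rightleftarrows^*r'\hookrightarrow s'\rightleftarrows^*s$. $\mathsf{SN}$: terms with no infinite $\rightsquigarrow$-sequence. Conjunction-free types $S::=\tau\mid S\Rightarrow S$. $\mathrm{can}(\tau)=\tau$; $\mathrm{can}(A\wedge B)=\mathrm{can}(A)\wedge\mathrm{can}(B)$; if $\mathrm{can}(A)=\bigwedge_{i=1}^n S_i$, $\mathrm{can}(B)=\bigwedge_{j=1}^m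 R_j$ (conjunction-free conjuncts listed left to right) then $\mathrm{can}(A\Rightarrow B)=\bigwedge_{j=1}^m(S_1\Rightarrow\cdots\Rightarrow S_n\Rightarrow R_j)$. Each $\mathrm{can}(A)$ has the form $\bigwedge_{i=1}^n D_i$ with $D_i=S_{i1}\Rightarrow\cdots\Rightarrow S_{im_i}\Rightarrow\tau$, $S_{ij}$ conjunction-free, $n\ge1$, $m_i\ge0$. Interpretation (by induction on types; for conjunction-free $S$, $\mathrm{can}(S)=S$): $[\![\bigwedge_{i=1}^n D_i]\!]=\{r\mid$ for all $i$ and all terms $s_{ij}\in[\![S_{ij}]\!]$ ($j=1,\dots,m_i$), $\pi_{D_i}(r)\,s_{i1}\cdots s_{im_i}\in\mathsf{SN}\}$. -}

module Defs where

open import Data.Nat using (ℕ; zero; suc; pred; _<ᵇ_; _≡ᵇ_)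
open import Data.Bool using (Bool; true; false; if_then_else_)
open import Data.Product using (_×_; _,_; ∃; ∃-syntax; Σ-syntax)
open import Data.List using (List; []; _∷_; _++_)
import Data.List as L
open import Data.List.NonEmpty as L⁺ using (List⁺; [_]; _⁺++⁺_; foldr₁; toList)
open import Data.List.Membership.Propositional using (_∈_)
open import Data.Empty using (⊥)
open import Relation.Nullary using (¬_; Dec; yes; no)
open import Relation.Binary.PropositionalEquality using (_≡_; refl; cong; cong₂)
open import Relation.Binary.Construct.Closure.ReflexiveTransitive using (Star)

infixr 7 _⇒_
infixr 8 _∧_

data Ty : Set where
  τ   : Ty
  _⇒_ : Ty → Ty → Ty
  _∧_ : Ty → Ty → Ty

_≟ᵀ_ : (A B : Ty) → Dec (A ≡ B)
τ ≟ᵀ τ = yes refl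
τ ≟ᵀ (_ ⇒ _) = no λ ()
τ ≟ᵀ (_ ∧ _) = no λ ()
(_ ⇒ _) ≟ᵀ τ = no λ ()
(_ ⇒ _) ≟ᵀ (_ ∧ _) = no λ ()
(_ ∧ _) ≟ᵀ τ = no λ ()
(_ ∧ _) ≟ᵀ (_ ⇒ _) = no λ ()
(A ⇒ B) ≟ᵀ (C ⇒ D) with A ≟ᵀ C | B ≟ᵀ D
... | yes refl | yes refl = yes refl
... | no p | _ = no λ { refl → p refl }
... | yes _ | no q = no λ { refl → q refl }
(A ∧ B) ≟ᵀ (C ∧ D) with A ≟ᵀ C | B ≟ᵀ D
... | yes refl | yes refl = yes refl
... | no p | _ = no λ { refl → p refl }
... | yes _ | no q = no λ { refl → q refl }

infix 4 _≡ᵀ_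
data _≡ᵀ_ : Ty → Ty → Set where
  ≡-refl  : ∀ {A} → A ≡ᵀ A
  ≡-sym   : ∀ {A B} → A ≡ᵀ B → B ≡ᵀ A
  ≡-trans : ∀ {A B C} → A ≡ᵀ B → B ≡ᵀ C → A ≡ᵀ C
  ≡-⇒     : ∀ {A A' B B'} → A ≡ᵀ A' → B ≡ᵀ B' → (A ⇒ B) ≡ᵀ (A' ⇒ B')
  ≡-∧     : ∀ {A A' B B'} → A ≡ᵀ A' → B ≡ᵀ B' → (A ∧ B) ≡ᵀ (A' ∧ B')
  ≡-comm  : ∀ {A B} → (A ∧ B) ≡ᵀ (B ∧ A)
  ≡-assoc : ∀ {A B C} → ((A ∧ B) ∧ C) ≡ᵀ (A ∧ (B ∧ C))
  ≡-distr : ∀ {A B C} → (A ⇒ (B ∧ C)) ≡ᵀ ((A ⇒ B) ∧ (A ⇒ C))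
  ≡-curry : ∀ {A B C} → ((A ∧ B) ⇒ C) ≡ᵀ (A ⇒ B ⇒ C)

-- Terms, with de Bruijn indices (so α-equivalent terms are equal);
-- every variable occurrence carries its type label, and λ carries the
-- label of its bound variable.  The free variable x^A at binder depth d
-- is written  var (d + x) A.

data Tm : Set where
  var  : ℕ → Ty → Tm
  lam  : Ty → Tm → Tm
  app  : Tm → Tm → Tm
  plus : Tm → Tm → Tm
  proj : Ty → Tm → Tm

down : List (ℕ × Ty) → List (ℕ × Ty)
down [] = []
down ((zero , A) ∷ xs) = down xs
down ((suc n , A) ∷ xs) = (n , A) ∷ down xs

vars : Tm → List (ℕ × Ty)
vars (var n A) = (n , A) ∷ []
vars (lam A r) = down (vars r)
vars (app r s) = vars r ++ vars s
vars (plus r s) = vars r ++ vars s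
vars (proj A r) = vars r

Functional : List (ℕ × Ty) → Set
Functional xs = ∀ {n A B} → (n , A) ∈ xs → (n , B) ∈ xs → A ≡ B

shift : ℕ → Tm → Tm
shift c (var n A) = if n <ᵇ c then var n A else var (suc n) A
shift c (lam A r) = lam A (shift (suc c) r)
shift c (app r s) = app (shift c r) (shift c s)
shift c (plus r s) = plus (shift c r) (shift c s)
shift c (proj A r) = proj A (shift c r)

substAt : ℕ → Tm → Tm → Tm
substAt k s (var n A) =
  if n <ᵇ k then var n A else (if n ≡ᵇ k then s else var (pred n) A)
substAt k s (lam A r) = lam A (substAt (suc k) (shift 0 s) r)
substAt k s (app r t) = app (substAt k s r) (substAt k s t)
substAt k s (plus r t) = plus (substAt k s r) (substAt k s t)
substAt k s (proj A r) = proj A (substAt k s r)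

_[_/0] : Tm → Tm → Tm
r [ s /0] = substAt 0 s r

repTy : Ty → Ty → Ty → Ty
repTy A B C with C ≟ᵀ B
... | yes _ = A
repTy A B τ | no _ = τ
repTy A B (C ⇒ D) | no _ = repTy A B C ⇒ repTy A B D
repTy A B (C ∧ D) | no _ = repTy A B C ∧ repTy A B D

_[_/ᵀ_] : Tm → Ty → Ty → Tm
var n C [ A /ᵀ B ] = var n (repTy A B C)
lam C r [ A /ᵀ B ] = lam (repTy A B C) (r [ A /ᵀ B ])
app r s [ A /ᵀ B ] = app (r [ A /ᵀ B ]) (s [ A /ᵀ B ])
plus r s [ A /ᵀ B ] = plus (r [ A /ᵀ B ]) (s [ A /ᵀ B ])
proj C r [ A /ᵀ B ] = proj (repTy A B C) (r [ A /ᵀ B ])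

infix 4 _∶_
data _∶_ : Tm → Ty → Set where
  ty-var  : ∀ {n A} → var n A ∶ A
  ty-eq   : ∀ {r A B} → r ∶ A → A ≡ᵀ B → r ∶ B
  ty-lam  : ∀ {r A B} → r ∶ B → Functional ((zero , A) ∷ vars r) →
            lam A r ∶ (A ⇒ B)
  ty-app  : ∀ {r s A B} → r ∶ (A ⇒ B) → s ∶ A → Functional (vars (app r s)) →
            app r s ∶ B
  ty-plus : ∀ {r s A B} → r ∶ A → s ∶ B → Functional (vars (plus r s)) →
            plus r s ∶ (A ∧ B)
  ty-proj : ∀ {r A} → r ∶ A → proj A r ∶ A
  ty-projE : ∀ {r A B} → r ∶ (A ∧ B) → proj A r ∶ A

-- Contexts  C[·] ::= [·] | λx^A.C | C r | r C | C + r | r + C | π_A(C)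
-- (plugging may capture variables, as usual for contexts)

data Ctx : Set where
  hole  : Ctx
  lamC  : Ty → Ctx → Ctx
  appL  : Ctx → Tm → Ctx
  appR  : Tm → Ctx → Ctx
  plusL : Ctx → Tm → Ctx
  plusR : Tm → Ctx → Ctx
  projC : Ty → Ctx → Ctx

plug : Ctx → Tm → Tm
plug hole t = t
plug (lamC A C) t = lam A (plug C t)
plug (appL C r) t = app (plug C t) r
plug (appR r C) t = app r (plug C t)
plug (plusL C r) t = plus (plug C t) r
plug (plusR r C) t = plus r (plug C t)
plug (projC A C) t = proj A (plug C t)

data _⇄ʳ_ : Tm → Tm → Set where
  comm   : ∀ {r s} → plus r s ⇄ʳ plus s r
  asso   : ∀ {r s t} → plus (plus r s) t ⇄ʳ plus r (plus s t)
  distλ  : ∀ {A r s} → lam A (plus r s) ⇄ʳ plus (lam A r) (lam A s)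
  distapp : ∀ {r s t} → app (plus r s) t ⇄ʳ plus (app r t) (app s t)
  πλ     : ∀ {A B r} → proj (A ⇒ B) (lam A r) ⇄ʳ lam A (proj B r)
  πapp   : ∀ {A B C r s} → r ∶ (A ⇒ (B ∧ C)) →
           app (proj (A ⇒ B) r) s ⇄ʳ proj B (app r s)
  curry  : ∀ {r s t} → app (app r s) t ⇄ʳ app r (plus s t)
  tyeq   : ∀ {A B r} → A ≡ᵀ B → r ⇄ʳ (r [ A /ᵀ B ])
  πplus  : ∀ {A B C D r s} → r ∶ (A ∧ B) → s ∶ (C ∧ D) →
           proj (A ∧ C) (plus r s) ⇄ʳ plus (proj A r) (proj C s)

data _⇄_ : Tm → Tm → Set where
  fwd : ∀ {r s} (C : Ctx) → r ⇄ʳ s → plug C r ⇄ plug C s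
  bwd : ∀ {r s} (C : Ctx) → r ⇄ʳ s → plug C s ⇄ plug C r

_⇄*_ : Tm → Tm → Set
_⇄*_ = Star _⇄_

-- A context C is ⇄*-equivalent to some context C'[π_A(·)], where the hole
-- stands for an arbitrary term of the type T of the redex.
UnderProj : Ctx → Ty → Set
UnderProj C T = ∃[ C' ] ∃[ A ] (∀ t → t ∶ T → plug C t ⇄* plug C' (proj A t))

data _↪ʳ_ : Tm → Tm → Set where
  β     : ∀ {A r s} → s ∶ A → app (lam A r) s ↪ʳ (r [ s /0])
  πplus : ∀ {A r s} → r ∶ A → proj A (plus r s) ↪ʳ r
  πid   : ∀ {A r} → r ∶ A → proj A r ↪ʳ r

data _↪_ : Tm → Tm → Set where
  ctx : ∀ {r s} (C : Ctx) → r ↪ʳ s → plug C r ↪ plug C s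
  δ   : ∀ {r A B} (C : Ctx) → r ∶ (A ∧ B) →
        (∀ s t → ¬ (r ⇄* plus s t)) →
        ¬ UnderProj C (A ∧ B) →
        plug C r ↪ plug C (plus (proj A r) (proj B r))

_⇝_ : Tm → Tm → Set
r ⇝ s = ∃[ r' ] ∃[ s' ] (r ⇄* r' × r' ↪ s' × s' ⇄* s)

data SN (r : Tm) : Set where
  sn : (∀ {s} → r ⇝ s → SN s) → SN r

conjuncts : Ty → List⁺ Ty
conjuncts (A ∧ B) = conjuncts A ⁺++⁺ conjuncts B
conjuncts A = [ A ]

⋀ : List⁺ Ty → Ty
⋀ = foldr₁ _∧_

can : Ty → Ty
can τ = τ
can (A ∧ B) = can A ∧ can B
can (A ⇒ B) =
  ⋀ (L⁺.map (λ R → L.foldr _⇒_ R (toList (conjuncts (can A)))) (conjuncts (can B)))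

-- Interpretation.
-- ⟦ ⋀ D_i ⟧ = { r | ∀ i, ∀ s_ij ∈ ⟦S_ij⟧, π_{D_i}(r) s_i1 ... s_im_i ∈ SN }
-- Red D t : for D = S_1 ⇒ ... ⇒ S_m ⇒ τ, ∀ s_j ∈ ⟦S_j⟧, t s_1 ... s_m ∈ SN.
-- (The ∧-case of Red never arises for canonical types.)

mutual
  ⟦_⟧ : Ty → Tm → Set
  ⟦ A ∧ B ⟧ r = ⟦ A ⟧ r × ⟦ B ⟧ r
  ⟦ τ ⟧ r = Red τ (proj τ r)
  ⟦ S ⇒ R ⟧ r = Red (S ⇒ R) (proj (S ⇒ R) r)

  Red : Ty → Tm → Set
  Red τ t = SN t
  Red (S ⇒ R) t = ∀ s → ⟦ S ⟧ s → Red R (app t s)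
  Red (A ∧ B) t = ⊥

-- Canonical forms are conjunctions of leaves S₁ ⇒ … ⇒ Sₙ ⇒ τ, and ⟦ can A ⟧ holds of r
-- exactly when it holds of r for every leaf. Each axiom of ≡ changes the list of leaves
-- of can A only up to permuting the leaves and permuting the premises of a leaf
-- (curry and distributivity even leave the list unchanged). Both kinds of permutation preserve the
-- interpretation: a permutation of conjuncts trivially, a permutation of premises because
-- (t a) b ⇄* (t b) a, so it only moves a term within its ⇄*-class, which SN cannot see.

module Submission where

open import Defs
open import Data.List using (List; []; _∷_; _++_; map; foldr)
import Data.List.Properties as List
open import Data.List.NonEmpty as List⁺ using (List⁺; toList)
open import Data.List.Relation.Unary.All using (All; []; _∷_)
import Data.List.Relation.Unary.All.Properties as All
open import Data.List.Relation.Binary.Pointwise as Pointwise using (Pointwise; []; _∷_)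
open import Data.Empty using (⊥-elim)
open import Data.Product using (_,_)
open import Function.Base using (_∘_)
open import Function.Bundles using (_⇔_; mk⇔; Equivalence)
import Function.Properties.Equivalence as ⇔
open import Relation.Binary.Bundles using (Setoid)
open import Relation.Binary.Construct.Closure.ReflexiveTransitive using (ε; _◅_; _◅◅_; gmap)
open import Relation.Binary.PropositionalEquality
  using (_≡_; refl; sym; cong; cong₂; subst; module ≡-Reasoning)
open import Relation.Nullary using (yes; no)
open import Relation.Unary using (_≐_)

open Equivalence using (to; from)

SN-resp-⇄* : ∀ {t t'} → t ⇄* t' → SN t → SN t'
SN-resp-⇄* t⇄*t' (sn reducts) =
  sn λ { (r , s , t'⇄*r , r↪s , s⇄*u) → reducts (r , s , t⇄*t' ◅◅ t'⇄*r , r↪s , s⇄*u) }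

app-⇄ˡ : ∀ {r r'} s → r ⇄ r' → app r s ⇄ app r' s
app-⇄ˡ s (fwd C step) = fwd (appL C s) step
app-⇄ˡ s (bwd C step) = bwd (appL C s) step

Red-resp-⇄* : ∀ D {t t'} → t ⇄* t' → Red D t → Red D t'
Red-resp-⇄* τ t⇄*t' = SN-resp-⇄* t⇄*t'
Red-resp-⇄* (S ⇒ R) t⇄*t' red s ⟦S⟧s =
  Red-resp-⇄* R (gmap (λ u → app u s) (app-⇄ˡ s) t⇄*t') (red s ⟦S⟧s)
Red-resp-⇄* (A ∧ B) t⇄*t' ()

repTy-self : ∀ A B → repTy A B B ≡ A
repTy-self A B with B ≟ᵀ B
... | yes _ = refl
... | no B≢B = ⊥-elim (B≢B refl)

-- The rule r ⇄ r[D'/D], applied to π_D(r), also relabels the projection; applying it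
-- backwards underneath the projection then restores r.
proj-resp-≡ᵀ : ∀ {D D'} r → D ≡ᵀ D' → proj D r ⇄* proj D' r
proj-resp-≡ᵀ {D} {D'} r D≡D' = relabel ◅ bwd (projC D' hole) (tyeq D'≡D) ◅ ε
  where
  D'≡D = ≡-sym D≡D'
  relabel : proj D r ⇄ proj D' (r [ D' /ᵀ D ])
  relabel = subst (λ X → proj D r ⇄ proj X (r [ D' /ᵀ D ])) (repTy-self D' D)
                  (fwd hole (tyeq D'≡D))

app-exchange : ∀ t a b → app (app t a) b ⇄* app (app t b) a
app-exchange t a b = fwd hole curry ◅ fwd (appR t hole) comm ◅ bwd hole curry ◅ ε

infix 4 _≈_
record _≈_ (D D' : Ty) : Set where
  field
    iso : D ≡ᵀ D'
    red : ∀ t → Red D t ⇔ Red D' t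
    sem : ∀ r → ⟦ D ⟧ r ⇔ ⟦ D' ⟧ r
open _≈_

≈-refl : ∀ {D} → D ≈ D
≈-refl = record { iso = ≡-refl ; red = λ _ → ⇔.refl ; sem = λ _ → ⇔.refl }

≈-sym : ∀ {D D'} → D ≈ D' → D' ≈ D
≈-sym e = record { iso = ≡-sym (iso e) ; red = ⇔.sym ∘ red e ; sem = ⇔.sym ∘ sem e }

≈-trans : ∀ {D D' D''} → D ≈ D' → D' ≈ D'' → D ≈ D''
≈-trans e f = record
  { iso = ≡-trans (iso e) (iso f)
  ; red = λ t → ⇔.trans (red e t) (red f t)
  ; sem = λ r → ⇔.trans (sem e r) (sem f r)
  }

≈-setoid : Setoid _ _
≈-setoid = record
  { Carrier = Ty ; _≈_ = _≈_
  ; isEquivalence = record { refl = ≈-refl ; sym = ≈-sym ; trans = ≈-trans } }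

-- For an arrow D, ⟦ D ⟧ r is Red D (π_D r), and proj-resp-≡ᵀ moves the label D.
≈-arrow : ∀ {A B C E} → (A ⇒ B) ≡ᵀ (C ⇒ E) → (∀ t → Red (A ⇒ B) t ⇔ Red (C ⇒ E) t) →
          (A ⇒ B) ≈ (C ⇒ E)
≈-arrow {A} {B} {C} {E} A⇒B≡C⇒E red⇔ = record
  { iso = A⇒B≡C⇒E
  ; red = red⇔
  ; sem = λ r → mk⇔
      (Red-resp-⇄* (C ⇒ E) (proj-resp-≡ᵀ r A⇒B≡C⇒E) ∘ to (red⇔ _))
      (Red-resp-⇄* (A ⇒ B) (proj-resp-≡ᵀ r (≡-sym A⇒B≡C⇒E)) ∘ from (red⇔ _))
  }

⇒-cong : ∀ {S S' R R'} → S ≈ S' → R ≈ R' → (S ⇒ R) ≈ (S' ⇒ R')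
⇒-cong S≈S' R≈R' = ≈-arrow (≡-⇒ (iso S≈S') (iso R≈R')) λ t → mk⇔
  (λ redSR s ⟦S'⟧s → to (red R≈R' (app t s)) (redSR s (from (sem S≈S' s) ⟦S'⟧s)))
  (λ redS'R' s ⟦S⟧s → from (red R≈R' (app t s)) (redS'R' s (to (sem S≈S' s) ⟦S⟧s)))

⇒-exchange : ∀ S S' R → (S ⇒ S' ⇒ R) ≈ (S' ⇒ S ⇒ R)
⇒-exchange S S' R = ≈-arrow (exchange S S') λ t → mk⇔ (swapped S S' t) (swapped S' S t)
  where
  exchange : ∀ S S' → (S ⇒ S' ⇒ R) ≡ᵀ (S' ⇒ S ⇒ R)
  exchange S S' = ≡-trans (≡-sym ≡-curry) (≡-trans (≡-⇒ ≡-comm ≡-refl) ≡-curry)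
  swapped : ∀ S S' t → Red (S ⇒ S' ⇒ R) t → Red (S' ⇒ S ⇒ R) t
  swapped S S' t redSS'R s' ⟦S'⟧s' s ⟦S⟧s =
    Red-resp-⇄* R (app-exchange t s s') (redSS'R s ⟦S⟧s s' ⟦S'⟧s')

open import Data.List.Relation.Binary.Permutation.Setoid ≈-setoid as ↭ using (_↭_)
import Data.List.Relation.Binary.Permutation.Setoid.Properties ≈-setoid as ↭ₚ

infixr 7 _⇒⋆_
_⇒⋆_ : List Ty → Ty → Ty
Ss ⇒⋆ R = foldr _⇒_ R Ss

⇒⋆-cong : ∀ {Ss Ss' R R'} → Pointwise _≈_ Ss Ss' → R ≈ R' → Ss ⇒⋆ R ≈ Ss' ⇒⋆ R'
⇒⋆-cong [] R≈R' = R≈R'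
⇒⋆-cong (S≈S' ∷ Ss≈Ss') R≈R' = ⇒-cong S≈S' (⇒⋆-cong Ss≈Ss' R≈R')

⇒⋆-congʳ : ∀ Ss {R R'} → R ≈ R' → Ss ⇒⋆ R ≈ Ss ⇒⋆ R'
⇒⋆-congʳ Ss = ⇒⋆-cong {Ss} {Ss} (Pointwise.refl ≈-refl)

⇒⋆-resp-↭ : ∀ {Ss Ss'} R → Ss ↭ Ss' → Ss ⇒⋆ R ≈ Ss' ⇒⋆ R
⇒⋆-resp-↭ R (↭.refl Ss≈Ss') = ⇒⋆-cong Ss≈Ss' ≈-refl
⇒⋆-resp-↭ R (↭.prep S≈S' p) = ⇒-cong S≈S' (⇒⋆-resp-↭ R p)
⇒⋆-resp-↭ R (↭.swap {xs} {_} {S} {S'} S≈ S'≈ p) =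
  ≈-trans (⇒-exchange S S' (xs ⇒⋆ R)) (⇒-cong S'≈ (⇒-cong S≈ (⇒⋆-resp-↭ R p)))
⇒⋆-resp-↭ R (↭.trans p q) = ≈-trans (⇒⋆-resp-↭ R p) (⇒⋆-resp-↭ R q)

conjunctList : Ty → List Ty
conjunctList A = toList (conjuncts A)

⟦⟧⇔All-conjuncts : ∀ X r → ⟦ X ⟧ r ⇔ All (λ D → ⟦ D ⟧ r) (conjunctList X)
⟦⟧⇔All-conjuncts τ r = mk⇔ (_∷ []) λ { (h ∷ []) → h }
⟦⟧⇔All-conjuncts (S ⇒ R) r = mk⇔ (_∷ []) λ { (h ∷ []) → h }
⟦⟧⇔All-conjuncts (A ∧ B) r = mk⇔
  (λ { (⟦A⟧r , ⟦B⟧r) →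
        All.++⁺ (to (⟦⟧⇔All-conjuncts A r) ⟦A⟧r) (to (⟦⟧⇔All-conjuncts B r) ⟦B⟧r) })
  (λ h → let hA , hB = All.++⁻ (conjunctList A) h in
         from (⟦⟧⇔All-conjuncts A r) hA , from (⟦⟧⇔All-conjuncts B r) hB)

-- Arrows with a nonempty list of premises are not conjunctions, so conjuncts undoes ⋀.
conjunctList-⋀-⇒⋆ : ∀ (Ss Rs : List⁺ Ty) →
  conjunctList (⋀ (List⁺.map (toList Ss ⇒⋆_) Rs)) ≡ map (toList Ss ⇒⋆_) (toList Rs)
conjunctList-⋀-⇒⋆ Ss (R List⁺.∷ Rs) = go R Rs
  where
  go : ∀ R Rs → conjunctList (⋀ (List⁺.map (toList Ss ⇒⋆_) (R List⁺.∷ Rs)))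
                ≡ map (toList Ss ⇒⋆_) (R ∷ Rs)
  go R [] = refl
  go R (R' ∷ Rs) = cong ((toList Ss ⇒⋆ R) ∷_) (go R' Rs)

leaves : Ty → List Ty
leaves A = conjunctList (can A)

leaves-⇒ : ∀ A B → leaves (A ⇒ B) ≡ map (leaves A ⇒⋆_) (leaves B)
leaves-⇒ A B = conjunctList-⋀-⇒⋆ (conjuncts (can A)) (conjuncts (can B))

leaves-distrib : ∀ A B C → leaves (A ⇒ B ∧ C) ≡ leaves ((A ⇒ B) ∧ (A ⇒ C))
leaves-distrib A B C = begin
  leaves (A ⇒ B ∧ C)                                        ≡⟨ leaves-⇒ A (B ∧ C) ⟩
  map (leaves A ⇒⋆_) (leaves B ++ leaves C)                 ≡⟨ List.map-++ _ (leaves B) (leaves C) ⟩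
  map (leaves A ⇒⋆_) (leaves B) ++ map (leaves A ⇒⋆_) (leaves C)
    ≡⟨ cong₂ _++_ (sym (leaves-⇒ A B)) (sym (leaves-⇒ A C)) ⟩
  leaves ((A ⇒ B) ∧ (A ⇒ C))                                ∎
  where open ≡-Reasoning

leaves-curry : ∀ A B C → leaves (A ∧ B ⇒ C) ≡ leaves (A ⇒ B ⇒ C)
leaves-curry A B C = begin
  leaves (A ∧ B ⇒ C)                                        ≡⟨ leaves-⇒ (A ∧ B) C ⟩
  map ((leaves A ++ leaves B) ⇒⋆_) (leaves C)
    ≡⟨ List.map-cong (λ R → List.foldr-++ _⇒_ R (leaves A) (leaves B)) (leaves C) ⟩
  map ((leaves A ⇒⋆_) ∘ (leaves B ⇒⋆_)) (leaves C)          ≡⟨ List.map-∘ (leaves C) ⟩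
  map (leaves A ⇒⋆_) (map (leaves B ⇒⋆_) (leaves C))        ≡⟨ cong (map _) (sym (leaves-⇒ B C)) ⟩
  map (leaves A ⇒⋆_) (leaves (B ⇒ C))                       ≡⟨ sym (leaves-⇒ A (B ⇒ C)) ⟩
  leaves (A ⇒ B ⇒ C)                                        ∎
  where open ≡-Reasoning

leaves-resp-≡ᵀ : ∀ {A B} → A ≡ᵀ B → leaves A ↭ leaves B
leaves-resp-≡ᵀ ≡-refl = ↭.↭-refl
leaves-resp-≡ᵀ (≡-sym p) = ↭.↭-sym (leaves-resp-≡ᵀ p)
leaves-resp-≡ᵀ (≡-trans p q) = ↭.trans (leaves-resp-≡ᵀ p) (leaves-resp-≡ᵀ q)
leaves-resp-≡ᵀ (≡-∧ p q) = ↭ₚ.++⁺ (leaves-resp-≡ᵀ p) (leaves-resp-≡ᵀ q)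
leaves-resp-≡ᵀ (≡-comm {A} {B}) = ↭ₚ.++-comm (leaves A) (leaves B)
leaves-resp-≡ᵀ (≡-assoc {A} {B} {C}) = ↭.↭-reflexive (List.++-assoc (leaves A) (leaves B) (leaves C))
leaves-resp-≡ᵀ (≡-distr {A} {B} {C}) = ↭.↭-reflexive (leaves-distrib A B C)
leaves-resp-≡ᵀ (≡-curry {A} {B} {C}) = ↭.↭-reflexive (leaves-curry A B C)
leaves-resp-≡ᵀ (≡-⇒ {A} {A'} {B} {B'} p q) = begin
  leaves (A ⇒ B)                    ≡⟨ leaves-⇒ A B ⟩
  map (leaves A ⇒⋆_) (leaves B)
    ↭⟨ ↭ₚ.map⁺ ≈-setoid (⇒⋆-congʳ (leaves A)) (leaves-resp-≡ᵀ q) ⟩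
  map (leaves A ⇒⋆_) (leaves B')
    ↭⟨ ↭.refl (Pointwise.map⁺ _ _ (Pointwise.refl (⇒⋆-resp-↭ _ (leaves-resp-≡ᵀ p)))) ⟩
  map (leaves A' ⇒⋆_) (leaves B')   ≡⟨ sym (leaves-⇒ A' B') ⟩
  leaves (A' ⇒ B')                  ∎
  where open ↭.PermutationReasoning

⟦⟧-resp-↭ : ∀ X Y → conjunctList X ↭ conjunctList Y → ∀ {r} → ⟦ X ⟧ r → ⟦ Y ⟧ r
⟦⟧-resp-↭ X Y X↭Y {r} =
  from (⟦⟧⇔All-conjuncts Y r)
  ∘ ↭ₚ.All-resp-↭ (λ D≈D' → to (sem D≈D' r)) X↭Y
  ∘ to (⟦⟧⇔All-conjuncts X r)

corollary1 : ∀ (A B : Ty) → A ≡ᵀ B → ⟦ can A ⟧ ≐ ⟦ can B ⟧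
corollary1 A B A≡B =
  ⟦⟧-resp-↭ (can A) (can B) (leaves-resp-≡ᵀ A≡B) ,
  ⟦⟧-resp-↭ (can B) (can A) (leaves-resp-≡ᵀ (≡-sym A≡B))
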